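{- Let $G=(V,E)$ be a finite loopless undirected graph (parallel edges allowed) and let $\{s,t\}$ be a separating vertex pair of $G$ such that $H$ and $K$ are two connected nontrivial subgraphs with $H\cup K=G$ and $H\cap K=(\{s,t\},\emptyset)$. Then $$\Phi_{st}(G,z)=\Phi_{st}(H,z)+\Phi_{st}(K,z)-(1-z)\left[\frac{\Phi_{st}(H,z)}{1-z}\odot\frac{\Phi_{st}(K,z)}{1-z}\right].$$
   Context: Spread process on a graph $F$ with infection probability $p=1-q\in(0,1]$ on every edge: at time $0$ the set $X_0=\{s\}$ is labelled; in each discrete time step, independently for every edge with exactly one labelled endpoint, the label is copied to the other endpoint with probability $p$, all simultaneously; labelled vertices stay labelled. $Z_{st}(F)=\min\{k: t\in X_k\}$ and $\Phi_{st}(F,z)=\sum_{n\ge0}\Pr(Z_{st}(F)=n)z^n$ (formal power series in $\mathbb{C}[[z]]$). The Hadamard product of $A(z)=\sum_i a_iz^i$ and $B(z)=\sum_i b_iz^i$ is $A(z)\odot B(z)=\sum_i a_ib_iz^i$; $1/(1-z)=\sum_{k\ge0}z^k$. -}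

module Defs where

open import Data.Nat using (ℕ; zero; suc)
open import Data.Fin using (Fin)
open import Data.Fin.Subset using (Subset; _∪_; _∩_; ⁅_⁆; ⊤; _∈_)
open import Data.Vec using (lookup)
open import Data.Bool using (Bool; true; false; if_then_else_; _xor_)
open import Data.List using (List; []; _∷_; _++_)
open import Data.List.Membership.Propositional renaming (_∈_ to _∈ₗ_)
open import Data.List.Relation.Unary.All using (All)
open import Data.Product using (_×_; _,_; proj₁; proj₂)
open import Relation.Binary.PropositionalEquality using (_≡_; _≢_)
open import Algebra.Bundles using (CommutativeRing)

-- Edges are unordered pairs (the pair (u , v) is read as the edge {u,v});
-- parallel edges are allowed (a List may contain repeats).
record Graph (n : ℕ) : Set where
  field
    verts       : Subset n
    edges       : List (Fin n × Fin n)
    edgesInside : All (λ e → (proj₁ e ∈ verts) × (proj₂ e ∈ verts)) edges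
    loopless    : All (λ e → proj₁ e ≢ proj₂ e) edges
open Graph public

data Reach {n : ℕ} (G : Graph n) : Fin n → Fin n → Set where
  here : ∀ {u} → u ∈ verts G → Reach G u u
  fwd  : ∀ {u v w} → Reach G u v → (v , w) ∈ₗ edges G → Reach G u w
  bwd  : ∀ {u v w} → Reach G u v → (w , v) ∈ₗ edges G → Reach G u w

Connected : ∀ {n} → Graph n → Set
Connected G = ∀ u v → u ∈ verts G → v ∈ verts G → Reach G u v

-- Spread process with infection probability p (q = 1 - p), computed in a
-- commutative ring R.  Formal power series are coefficient sequences ℕ → R.
module Spread {c ℓ} (R : CommutativeRing c ℓ) (p : CommutativeRing.Carrier R) where
  open CommutativeRing R using (Carrier; _+_; _*_; -_; 0#; 1#)

  _−_ : Carrier → Carrier → Carrier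
  x − y = x + (- y)

  q : Carrier
  q = 1# − p

  -- One time step from the labelled set X: each edge of the list having exactly
  -- one endpoint in X independently succeeds (weight p, its endpoints get
  -- labelled) or fails (weight q).  Y accumulates the new labelled set and g is
  -- evaluated at the resulting set: this is  Σ_Y Pr(X_{k+1} = Y | X_k = X) g(Y).
  step : ∀ {n} → Subset n → List (Fin n × Fin n) → Subset n → (Subset n → Carrier) → Carrier
  step X [] Y g = g Y
  step X ((u , v) ∷ es) Y g =
    if lookup X u xor lookup X v
      then p * step X es (Y ∪ (⁅ u ⁆ ∪ ⁅ v ⁆)) g + q * step X es Y g
      else step X es Y g

  -- hit G t k X = Pr(Z = k) for the process on G started from labelled set X,
  -- where Z is the first time t is labelled.
  hit : ∀ {n} → Graph n → Fin n → ℕ → Subset n → Carrier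
  hit G t zero    X = if lookup X t then 1# else 0#
  hit G t (suc k) X = if lookup X t then 0# else step X (edges G) X (hit G t k)

  Series : Set c
  Series = ℕ → Carrier

  -- Φ_st(G, z) as its coefficient sequence: coefficient k is Pr(Z_st(G) = k)
  Φ : ∀ {n} → Graph n → Fin n → Fin n → Series
  Φ G s t k = hit G t k ⁅ s ⁆

  _+ₛ_ : Series → Series → Series
  (A +ₛ B) k = A k + B k

  _−ₛ_ : Series → Series → Series
  (A −ₛ B) k = A k − B k

  _⊙_ : Series → Series → Series
  (A ⊙ B) k = A k * B k

  -- A(z) / (1 - z) = A(z) · Σ_k z^k
  div1-z : Series → Series
  div1-z A zero    = A zero
  div1-z A (suc k) = div1-z A k + A (suc k)

  mul1-z : Series → Series
  mul1-z A zero    = A zero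
  mul1-z A (suc k) = A (suc k) − A k

-- Let S_F(k) = Pr(Z_st(F) > k). Once s is labelled, H and K can influence each other only through s and t,
-- so as long as t is unlabelled the spread inside H and the spread inside K are independent: S_G = S_H S_K.
-- The coefficients of Φ_F(z)/(1 - z) are D_F(k) = 1 - S_F(k), hence D_G = D_H + D_K - D_H ⊙ D_K by
-- inclusion–exclusion, and multiplying by 1 - z gives the formula.

module Submission where

open import Defs
open import Data.Nat using (ℕ; zero; suc)
open import Data.Fin using (Fin)
open import Data.Fin.Subset using (Subset; _∪_; _∩_; ⁅_⁆; ⊤; ⊥; _∈_; _⊆_)
open import Data.Fin.Subset.Properties
  using (∪-assoc; ∪-comm; ∪-identityʳ; ⊥⊆; x∈p∪q⁺; x∈p∪q⁻; x∈p∩q⁺; x∈p∩q⁻; x∈⁅x⁆; x∈⁅y⁆⇒x≡y;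
         ⊆-reflexive; _∈?_)
open import Data.List using (List; []; _∷_; _++_)
open import Data.List.Relation.Binary.Permutation.Propositional as ↭ using (_↭_)
open import Data.List.Relation.Unary.All using (All; []; _∷_)
open import Data.Vec using (lookup)
open import Data.Vec.Properties using (lookup-zipWith; []=⇒lookup; lookup⇒[]=)
open import Data.Bool using (true; false; _∨_; if_then_else_; _xor_)
open import Data.Bool.Properties using (∨-identityʳ)
open import Data.Product using (_×_; _,_; proj₁; proj₂)
open import Data.Sum using (_⊎_; inj₁; inj₂)
open import Relation.Nullary using (yes; no; contradiction)
open import Relation.Binary.PropositionalEquality as ≡ using (_≡_; _≢_)
open import Algebra.Bundles using (CommutativeRing)

Edges : ℕ → Set
Edges n = List (Fin n × Fin n)

EdgesWithin : ∀ {n} → Subset n → Edges n → Set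
EdgesWithin V = All (λ e → proj₁ e ∈ V × proj₂ e ∈ V)

AgreeOn : ∀ {n} → Subset n → Subset n → Subset n → Set
AgreeOn V X X′ = ∀ {i} → i ∈ V → lookup X i ≡ lookup X′ i

∪-least : ∀ {n} {A B V : Subset n} → A ⊆ V → B ⊆ V → A ∪ B ⊆ V
∪-least {A = A} {B} A⊆V B⊆V i∈A∪B with x∈p∪q⁻ A B i∈A∪B
... | inj₁ i∈A = A⊆V i∈A
... | inj₂ i∈B = B⊆V i∈B

⁅⁆-⊆ : ∀ {n} {V : Subset n} {u} → u ∈ V → ⁅ u ⁆ ⊆ V
⁅⁆-⊆ {u = u} u∈V i∈⁅u⁆ = ≡.subst (_∈ _) (≡.sym (x∈⁅y⁆⇒x≡y u i∈⁅u⁆)) u∈V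

∪-swapʳ : ∀ {n} (Y A B : Subset n) → (Y ∪ A) ∪ B ≡ (Y ∪ B) ∪ A
∪-swapʳ Y A B = begin
  (Y ∪ A) ∪ B ≡⟨ ∪-assoc Y A B ⟩
  Y ∪ (A ∪ B) ≡⟨ ≡.cong (Y ∪_) (∪-comm A B) ⟩
  Y ∪ (B ∪ A) ≡⟨ ∪-assoc Y B A ⟨
  (Y ∪ B) ∪ A ∎
  where open ≡.≡-Reasoning

∪-agreeOn : ∀ {n} {V X X′ : Subset n} A → AgreeOn V X X′ → AgreeOn V (X ∪ A) (X′ ∪ A)
∪-agreeOn {X = X} {X′} A agree {i} i∈V = begin
  lookup (X ∪ A) i         ≡⟨ lookup-zipWith _∨_ i X A ⟩
  lookup X i ∨ lookup A i  ≡⟨ ≡.cong (_∨ lookup A i) (agree i∈V) ⟩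
  lookup X′ i ∨ lookup A i ≡⟨ lookup-zipWith _∨_ i X′ A ⟨
  lookup (X′ ∪ A) i        ∎
  where open ≡.≡-Reasoning

∪-agreeOn-redundant : ∀ {n} {V Z : Subset n} B → (∀ {i} → i ∈ V → i ∈ B → i ∈ Z) →
                      AgreeOn V (Z ∪ B) Z
∪-agreeOn-redundant {Z = Z} B B∩V⊆Z {i} i∈V with lookup B i in i∈?B
... | true  = ≡.trans ([]=⇒lookup (x∈p∪q⁺ {p = Z} (inj₂ i∈B))) (≡.sym ([]=⇒lookup (B∩V⊆Z i∈V i∈B)))
  where i∈B = lookup⇒[]= i B i∈?B
... | false = ≡.trans (lookup-zipWith _∨_ i Z B) (≡.trans (≡.cong (lookup Z i ∨_) i∈?B) (∨-identityʳ _))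

module SpreadProperties {c ℓ} (R : CommutativeRing c ℓ) (p : CommutativeRing.Carrier R) where
  open CommutativeRing R hiding (zero)
    renaming (refl to ≈-refl; sym to ≈-sym; trans to ≈-trans; reflexive to ≈-reflexive)
  open import Algebra.Properties.Ring ring using (x≈z//y; xyx⁻¹≈y; //-rightDividesˡ; -‿+-comm; +-cancelʳ)
  open import Algebra.Properties.CommutativeSemigroup +-commutativeSemigroup
    using () renaming (interchange to +-interchange)
  open import Algebra.Properties.CommutativeSemigroup *-commutativeSemigroup using (x∙yz≈y∙xz)
  open import Algebra.Solver.Ring.NaturalCoefficients.Default commutativeSemiring
  open import Relation.Binary.Reasoning.Setoid setoid
  open Spread R p

  p+q≈1 : p + q ≈ 1#
  p+q≈1 = ≈-trans (+-comm p q) (//-rightDividesˡ p 1#)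

  step-cong : ∀ {n} (X : Subset n) es Y {g h : Subset n → Carrier} → (∀ Z → g Z ≈ h Z) →
              step X es Y g ≈ step X es Y h
  step-cong X [] Y g≈h = g≈h Y
  step-cong X ((u , v) ∷ es) Y g≈h with lookup X u xor lookup X v
  ... | true  = +-cong (*-congˡ (step-cong X es _ g≈h)) (*-congˡ (step-cong X es Y g≈h))
  ... | false = step-cong X es Y g≈h

  step-const : ∀ {n} (X : Subset n) es Y x → step X es Y (λ _ → x) ≈ x
  step-const X [] Y x = ≈-refl
  step-const X ((u , v) ∷ es) Y x with lookup X u xor lookup X v
  ... | true  = begin
    p * step X es _ (λ _ → x) + q * step X es Y (λ _ → x)
      ≈⟨ +-cong (*-congˡ (step-const X es _ x)) (*-congˡ (step-const X es Y x)) ⟩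
    p * x + q * x  ≈⟨ distribʳ x p q ⟨
    (p + q) * x    ≈⟨ *-congʳ p+q≈1 ⟩
    1# * x         ≈⟨ *-identityˡ x ⟩
    x              ∎
  ... | false = step-const X es Y x

  step-+ : ∀ {n} (X : Subset n) es Y {g h : Subset n → Carrier} →
           step X es Y (λ Z → g Z + h Z) ≈ step X es Y g + step X es Y h
  step-+ X [] Y = ≈-refl
  step-+ X ((u , v) ∷ es) Y with lookup X u xor lookup X v
  ... | true  = ≈-trans (+-cong (*-congˡ (step-+ X es _)) (*-congˡ (step-+ X es Y)))
                  (≈-trans (+-cong (distribˡ p _ _) (distribˡ q _ _)) (+-interchange _ _ _ _))
  ... | false = step-+ X es Y

  step-*ˡ : ∀ {n} (X : Subset n) es Y x {g : Subset n → Carrier} →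
            step X es Y (λ Z → x * g Z) ≈ x * step X es Y g
  step-*ˡ X [] Y x = ≈-refl
  step-*ˡ X ((u , v) ∷ es) Y x with lookup X u xor lookup X v
  ... | true  = ≈-trans (+-cong (*-congˡ (step-*ˡ X es _ x)) (*-congˡ (step-*ˡ X es Y x)))
                  (≈-trans (+-cong (x∙yz≈y∙xz p x _) (x∙yz≈y∙xz q x _)) (≈-sym (distribˡ x _ _)))
  ... | false = step-*ˡ X es Y x

  step-*ʳ : ∀ {n} (X : Subset n) es Y x {g : Subset n → Carrier} →
            step X es Y (λ Z → g Z * x) ≈ step X es Y g * x
  step-*ʳ X es Y x = ≈-trans (step-cong X es Y (λ Z → *-comm _ x)) (≈-trans (step-*ˡ X es Y x) (*-comm x _))

  step-++ : ∀ {n} (X : Subset n) es₁ es₂ Y (g : Subset n → Carrier) →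
            step X (es₁ ++ es₂) Y g ≡ step X es₁ Y (λ Y′ → step X es₂ Y′ g)
  step-++ X [] es₂ Y g = ≡.refl
  step-++ X ((u , v) ∷ es₁) es₂ Y g with lookup X u xor lookup X v
  ... | true  = ≡.cong₂ (λ a b → p * a + q * b) (step-++ X es₁ es₂ _ g) (step-++ X es₁ es₂ Y g)
  ... | false = step-++ X es₁ es₂ Y g

  step-swap : ∀ {n} (X : Subset n) e e′ es Y (g : Subset n → Carrier) →
              step X (e ∷ e′ ∷ es) Y g ≈ step X (e′ ∷ e ∷ es) Y g
  step-swap X (u , v) (u′ , v′) es Y g with lookup X u xor lookup X v | lookup X u′ xor lookup X v′
  ... | true  | true  = ≈-trans (+-congʳ (*-congˡ (+-congʳ (*-congˡ both-fire))))
                                (middle-swap p q _ _ _ _)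
    where
    both-fire : step X es ((Y ∪ (⁅ u ⁆ ∪ ⁅ v ⁆)) ∪ (⁅ u′ ⁆ ∪ ⁅ v′ ⁆)) g
              ≈ step X es ((Y ∪ (⁅ u′ ⁆ ∪ ⁅ v′ ⁆)) ∪ (⁅ u ⁆ ∪ ⁅ v ⁆)) g
    both-fire = ≈-reflexive (≡.cong (λ Z → step X es Z g) (∪-swapʳ Y _ _))
    middle-swap : ∀ x y a b c d →
                  x * (x * a + y * b) + y * (x * c + y * d) ≈ x * (x * a + y * c) + y * (x * b + y * d)
    middle-swap = solve 6 (λ x y a b c d → x :* (x :* a :+ y :* b) :+ y :* (x :* c :+ y :* d)
                                        := x :* (x :* a :+ y :* c) :+ y :* (x :* b :+ y :* d)) ≈-refl
  ... | true  | false = ≈-refl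
  ... | false | true  = ≈-refl
  ... | false | false = ≈-refl

  step-prep : ∀ {n} (X : Subset n) e {es es′} {g : Subset n → Carrier} →
              (∀ Y → step X es Y g ≈ step X es′ Y g) → ∀ Y → step X (e ∷ es) Y g ≈ step X (e ∷ es′) Y g
  step-prep X (u , v) es≈es′ Y with lookup X u xor lookup X v
  ... | true  = +-cong (*-congˡ (es≈es′ _)) (*-congˡ (es≈es′ Y))
  ... | false = es≈es′ Y

  step-↭ : ∀ {n} (X : Subset n) {es es′} → es ↭ es′ → ∀ Y (g : Subset n → Carrier) →
           step X es Y g ≈ step X es′ Y g
  step-↭ X ↭.refl Y g = ≈-refl
  step-↭ X (↭.prep {xs} {ys} e r) Y g = step-prep X e {xs} {ys} (λ Y′ → step-↭ X r Y′ g) Y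
  step-↭ X (↭.swap {xs} {ys} e e′ r) Y g =
    ≈-trans (step-swap X e e′ xs Y g)
            (step-prep X e′ {e ∷ xs} {e ∷ ys} (step-prep X e {xs} {ys} (λ Y′ → step-↭ X r Y′ g)) Y)
  step-↭ X (↭.trans r₁ r₂) Y g = ≈-trans (step-↭ X r₁ Y g) (step-↭ X r₂ Y g)

  step-local : ∀ {n} {V X X′ : Subset n} {es} → AgreeOn V X X′ → EdgesWithin V es →
               ∀ Y Y′ {g g′ : Subset n → Carrier} → (∀ A → A ⊆ V → g (Y ∪ A) ≈ g′ (Y′ ∪ A)) →
               step X es Y g ≈ step X′ es Y′ g′
  step-local agree [] Y Y′ {g} {g′} g≈g′ =
    ≡.subst₂ _≈_ (≡.cong g (∪-identityʳ Y)) (≡.cong g′ (∪-identityʳ Y′)) (g≈g′ ⊥ ⊥⊆)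
  step-local {V = V} {X} {X′} {(u , v) ∷ es} agree ((u∈V , v∈V) ∷ within) Y Y′ {g} {g′} g≈g′
    rewrite agree u∈V | agree v∈V with lookup X′ u xor lookup X′ v
  ... | true  = +-cong (*-congˡ (step-local agree within _ _ shifted))
                       (*-congˡ (step-local agree within Y Y′ g≈g′))
    where
    e = ⁅ u ⁆ ∪ ⁅ v ⁆
    shifted : ∀ A → A ⊆ V → g ((Y ∪ e) ∪ A) ≈ g′ ((Y′ ∪ e) ∪ A)
    shifted A A⊆V =
      ≡.subst₂ _≈_ (≡.cong g (≡.sym (∪-assoc Y e A))) (≡.cong g′ (≡.sym (∪-assoc Y′ e A)))
               (g≈g′ (e ∪ A) (∪-least (∪-least (⁅⁆-⊆ u∈V) (⁅⁆-⊆ v∈V)) A⊆V))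
  ... | false = step-local agree within Y Y′ g≈g′

  step-++-product : ∀ {n} {V₁ V₂ : Subset n} {es₁ es₂} → EdgesWithin V₁ es₁ → EdgesWithin V₂ es₂ →
                    ∀ X Y {g g₁ g₂ : Subset n → Carrier} →
                    (∀ A B → A ⊆ V₁ → B ⊆ V₂ → g ((Y ∪ A) ∪ B) ≈ g₁ (Y ∪ A) * g₂ (Y ∪ B)) →
                    step X (es₁ ++ es₂) Y g ≈ step X es₁ Y g₁ * step X es₂ Y g₂
  step-++-product {es₁ = es₁} {es₂} within₁ within₂ X Y {g} {g₁} {g₂} split = begin
    step X (es₁ ++ es₂) Y g                        ≡⟨ step-++ X es₁ es₂ Y g ⟩
    step X es₁ Y (λ Y₁ → step X es₂ Y₁ g)          ≈⟨ step-local (λ _ → ≡.refl) within₁ Y Y second ⟩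
    step X es₁ Y (λ Y₁ → g₁ Y₁ * step X es₂ Y g₂)  ≈⟨ step-*ʳ X es₁ Y _ ⟩
    step X es₁ Y g₁ * step X es₂ Y g₂              ∎
    where
    second : ∀ A → A ⊆ _ → step X es₂ (Y ∪ A) g ≈ g₁ (Y ∪ A) * step X es₂ Y g₂
    second A A⊆V₁ =
      ≈-trans (step-local (λ _ → ≡.refl) within₂ (Y ∪ A) Y (λ B B⊆V₂ → split A B A⊆V₁ B⊆V₂))
              (step-*ˡ X es₂ Y _)

  -- surv es t k X = Pr(t is still unlabelled at time k), for the process on es started from X.
  surv : ∀ {n} → Edges n → Fin n → ℕ → Subset n → Carrier
  surv es t zero    X = if lookup X t then 0# else 1#
  surv es t (suc k) X = if lookup X t then 0# else step X es X (surv es t k)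

  surv-labelled : ∀ {n} es (t : Fin n) k {X} → t ∈ X → surv es t k X ≡ 0#
  surv-labelled es t zero    t∈X rewrite []=⇒lookup t∈X = ≡.refl
  surv-labelled es t (suc k) t∈X rewrite []=⇒lookup t∈X = ≡.refl

  surv-local : ∀ {n} {V : Subset n} {es t} → EdgesWithin V es → t ∈ V →
               ∀ k {X X′} → AgreeOn V X X′ → surv es t k X ≈ surv es t k X′
  surv-local within t∈V zero agree rewrite agree t∈V = ≈-refl
  surv-local {t = t} within t∈V (suc k) {X} {X′} agree rewrite agree t∈V with lookup X′ t
  ... | true  = ≈-refl
  ... | false = step-local agree within X X′
                  (λ A _ → surv-local within t∈V k (∪-agreeOn {X = X} {X′} A agree))

  surv-↭ : ∀ {n} {es es′} → es ↭ es′ → ∀ (t : Fin n) k X → surv es t k X ≈ surv es′ t k X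
  surv-↭ r t zero    X = ≈-refl
  surv-↭ {es = es} {es′} r t (suc k) X with lookup X t
  ... | true  = ≈-refl
  ... | false = ≈-trans (step-↭ X r X (surv es t k)) (step-cong X es′ X (surv-↭ r t k))

  hit+surv≈1 : ∀ {n} (G : Graph n) t X → hit G t 0 X + surv (edges G) t 0 X ≈ 1#
  hit+surv≈1 G t X with lookup X t
  ... | true  = +-identityʳ 1#
  ... | false = +-identityˡ 1#

  hit+surv≈surv : ∀ {n} (G : Graph n) t k X →
                  hit G t (suc k) X + surv (edges G) t (suc k) X ≈ surv (edges G) t k X
  hit+surv≈surv G t zero X with lookup X t
  ... | true  = +-identityˡ 0#
  ... | false = ≈-trans (≈-sym (step-+ X (edges G) X))
                        (≈-trans (step-cong X (edges G) X (hit+surv≈1 G t)) (step-const X (edges G) X 1#))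
  hit+surv≈surv G t (suc k) X with lookup X t
  ... | true  = +-identityˡ 0#
  ... | false = ≈-trans (≈-sym (step-+ X (edges G) X)) (step-cong X (edges G) X (hit+surv≈surv G t k))

  cdf+surv≈1 : ∀ {n} (G : Graph n) t X k → div1-z (λ j → hit G t j X) k + surv (edges G) t k X ≈ 1#
  cdf+surv≈1 G t X zero    = hit+surv≈1 G t X
  cdf+surv≈1 G t X (suc k) = ≈-trans (+-assoc _ _ _)
                               (≈-trans (+-congˡ (hit+surv≈surv G t k X)) (cdf+surv≈1 G t X k))

  module _ {n} {VH VK : Subset n} {esH esK : Edges n} {s t : Fin n}
           (H-within : EdgesWithin VH esH) (K-within : EdgesWithin VK esK)
           (VH∩VK⊆st : VH ∩ VK ⊆ ⁅ s ⁆ ∪ ⁅ t ⁆) (t∈VH : t ∈ VH) (t∈VK : t ∈ VK) where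

    private
      shared : ∀ {i} → i ∈ VH → i ∈ VK → i ≡ s ⊎ i ≡ t
      shared i∈VH i∈VK with x∈p∪q⁻ ⁅ s ⁆ ⁅ t ⁆ (VH∩VK⊆st (x∈p∩q⁺ (i∈VH , i∈VK)))
      ... | inj₁ i∈⁅s⁆ = inj₁ (x∈⁅y⁆⇒x≡y s i∈⁅s⁆)
      ... | inj₂ i∈⁅t⁆ = inj₂ (x∈⁅y⁆⇒x≡y t i∈⁅t⁆)

      -- Once s is labelled, the labels added inside K can matter to H only at t, and vice versa.
      surv-on-sides : ∀ k {Y} A B → s ∈ Y → A ⊆ VH → B ⊆ VK →
                      surv esH t k ((Y ∪ A) ∪ B) * surv esK t k ((Y ∪ A) ∪ B)
                      ≈ surv esH t k (Y ∪ A) * surv esK t k (Y ∪ B)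
      surv-on-sides k {Y} A B s∈Y A⊆VH B⊆VK with t ∈? ((Y ∪ A) ∪ B)
      ... | yes t∈W = ≈-trans (vanishesˡ (surv-labelled esH t k t∈W)) (≈-sym one-side-vanishes)
        where
        vanishesˡ : ∀ {x y} → x ≡ 0# → x * y ≈ 0#
        vanishesˡ x≡0 = ≈-trans (*-congʳ (≈-reflexive x≡0)) (zeroˡ _)
        one-side-vanishes : surv esH t k (Y ∪ A) * surv esK t k (Y ∪ B) ≈ 0#
        one-side-vanishes with x∈p∪q⁻ (Y ∪ A) B t∈W
        ... | inj₁ t∈Y∪A = vanishesˡ (surv-labelled esH t k t∈Y∪A)
        ... | inj₂ t∈B   = ≈-trans (*-comm _ _) (vanishesˡ (surv-labelled esK t k (x∈p∪q⁺ {p = Y} (inj₂ t∈B))))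
      ... | no t∉W = *-cong (surv-local H-within t∈VH k (∪-agreeOn-redundant B B-harmless))
                            (surv-local K-within t∈VK k agreeK)
        where
        B-harmless : ∀ {i} → i ∈ VH → i ∈ B → i ∈ Y ∪ A
        B-harmless i∈VH i∈B with shared i∈VH (B⊆VK i∈B)
        ... | inj₁ ≡.refl = x∈p∪q⁺ (inj₁ s∈Y)
        ... | inj₂ ≡.refl = contradiction (x∈p∪q⁺ {p = Y ∪ A} (inj₂ i∈B)) t∉W
        A-harmless : ∀ {i} → i ∈ VK → i ∈ A → i ∈ Y ∪ B
        A-harmless i∈VK i∈A with shared (A⊆VH i∈A) i∈VK
        ... | inj₁ ≡.refl = x∈p∪q⁺ (inj₁ s∈Y)
        ... | inj₂ ≡.refl = contradiction (x∈p∪q⁺ (inj₁ (x∈p∪q⁺ {p = Y} (inj₂ i∈A)))) t∉W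
        agreeK : AgreeOn VK ((Y ∪ A) ∪ B) (Y ∪ B)
        agreeK i∈VK = ≡.trans (≡.cong (λ Z → lookup Z _) (∪-swapʳ Y A B))
                              (∪-agreeOn-redundant A A-harmless i∈VK)

    surv-++ : ∀ k Y → s ∈ Y → surv (esH ++ esK) t k Y ≈ surv esH t k Y * surv esK t k Y
    surv-++ zero Y s∈Y with lookup Y t
    ... | true  = ≈-sym (zeroˡ 0#)
    ... | false = ≈-sym (*-identityʳ 1#)
    surv-++ (suc k) Y s∈Y with lookup Y t
    ... | true  = ≈-sym (zeroˡ 0#)
    ... | false = step-++-product H-within K-within Y Y
                    (λ A B A⊆VH B⊆VK → ≈-trans (surv-++ k _ (x∈p∪q⁺ (inj₁ (x∈p∪q⁺ (inj₁ s∈Y)))))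
                                               (surv-on-sides k A B s∈Y A⊆VH B⊆VK))

  -- Subtraction is avoided until the last step, so that the semiring solver suffices.
  inclusion-exclusion : ∀ {a a′ b b′ c c′} → a + a′ ≈ 1# → b + b′ ≈ 1# → c + c′ ≈ 1# → c′ ≈ a′ * b′ →
                        c ≈ (a + b) − (a * b)
  inclusion-exclusion {a} {a′} {b} {b′} {c} {c′} a+a′≈1 b+b′≈1 c+c′≈1 c′≈a′b′ =
    x≈z//y c (a * b) (a + b) (+-cancelʳ c′ _ _ (begin
      (c + a * b) + c′                         ≈⟨ rearrange c (a * b) c′ ⟩
      (c + c′) + a * b                         ≈⟨ +-congʳ (≈-trans c+c′≈1 (≈-sym [a+a′][b+b′]≈1)) ⟩
      (a + a′) * (b + b′) + a * b              ≈⟨ expand a a′ b b′ ⟩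
      (a * (b + b′) + b * (a + a′)) + a′ * b′  ≈⟨ +-cong (+-cong (times-one b+b′≈1) (times-one a+a′≈1))
                                                         (≈-sym c′≈a′b′) ⟩
      (a + b) + c′                             ∎))
    where
    [a+a′][b+b′]≈1 : (a + a′) * (b + b′) ≈ 1#
    [a+a′][b+b′]≈1 = ≈-trans (*-cong a+a′≈1 b+b′≈1) (*-identityˡ 1#)
    times-one : ∀ {x y} → y ≈ 1# → x * y ≈ x
    times-one y≈1 = ≈-trans (*-congˡ y≈1) (*-identityʳ _)
    rearrange : ∀ x y z → (x + y) + z ≈ (x + z) + y
    rearrange = solve 3 (λ x y z → (x :+ y) :+ z := (x :+ z) :+ y) ≈-refl
    expand : ∀ x x′ y y′ → (x + x′) * (y + y′) + x * y ≈ (x * (y + y′) + y * (x + x′)) + x′ * y′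
    expand = solve 4 (λ x x′ y y′ → (x :+ x′) :* (y :+ y′) :+ x :* y
                                  := (x :* (y :+ y′) :+ y :* (x :+ x′)) :+ x′ :* y′) ≈-refl

  +-−-interchange : ∀ x y z w → (x + y) − (z + w) ≈ (x − z) + (y − w)
  +-−-interchange x y z w = ≈-trans (+-congˡ (≈-sym (-‿+-comm z w))) (+-interchange x y (- z) (- w))

  mul1-z-div1-z : ∀ A k → mul1-z (div1-z A) k ≈ A k
  mul1-z-div1-z A zero    = ≈-refl
  mul1-z-div1-z A (suc k) = xyx⁻¹≈y (div1-z A k) (A (suc k))

  mul1-z-cong : ∀ {A B} → (∀ k → A k ≈ B k) → ∀ k → mul1-z A k ≈ mul1-z B k
  mul1-z-cong A≈B zero    = A≈B zero
  mul1-z-cong A≈B (suc k) = +-cong (A≈B (suc k)) (-‿cong (A≈B k))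

  mul1-z-+ : ∀ A B k → mul1-z (A +ₛ B) k ≈ (mul1-z A +ₛ mul1-z B) k
  mul1-z-+ A B zero    = ≈-refl
  mul1-z-+ A B (suc k) = +-−-interchange _ _ _ _

  mul1-z-− : ∀ A B k → mul1-z (A −ₛ B) k ≈ (mul1-z A −ₛ mul1-z B) k
  mul1-z-− A B zero    = ≈-refl
  mul1-z-− A B (suc k) = ≈-trans (+-−-interchange _ _ _ _) (+-congˡ (-‿+-comm (B (suc k)) (- B k)))

mainTheorem6 : ∀ {c ℓ} (R : CommutativeRing c ℓ) (p : CommutativeRing.Carrier R)
    {n : ℕ} (G H K : Graph n) (s t : Fin n) →
    s ≢ t →
    verts G ≡ ⊤ →
    verts H ∪ verts K ≡ verts G →
    verts H ∩ verts K ≡ ⁅ s ⁆ ∪ ⁅ t ⁆ →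
    edges G ↭ (edges H ++ edges K) →
    Connected H → Connected K →
    ∀ k → CommutativeRing._≈_ R (Spread.Φ R p G s t k)
    (Spread._−ₛ_ R p (Spread._+ₛ_ R p (Spread.Φ R p H s t) (Spread.Φ R p K s t))
    (Spread.mul1-z R p (Spread._⊙_ R p (Spread.div1-z R p (Spread.Φ R p H s t))
    (Spread.div1-z R p (Spread.Φ R p K s t)))) k)
mainTheorem6 R p G H K s t _ _ _ H∩K≡st G↭H++K _ _ k = begin
  Φ G s t k                                         ≈⟨ mul1-z-div1-z (Φ G s t) k ⟨
  mul1-z (div1-z (Φ G s t)) k                       ≈⟨ mul1-z-cong cdf-splits k ⟩
  mul1-z ((FH +ₛ FK) −ₛ (FH ⊙ FK)) k                ≈⟨ mul1-z-− (FH +ₛ FK) (FH ⊙ FK) k ⟩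
  mul1-z (FH +ₛ FK) k − mul1-z (FH ⊙ FK) k          ≈⟨ +-congʳ (mul1-z-+ FH FK k) ⟩
  (mul1-z FH k + mul1-z FK k) − mul1-z (FH ⊙ FK) k  ≈⟨ +-congʳ (+-cong (mul1-z-div1-z (Φ H s t) k)
                                                                        (mul1-z-div1-z (Φ K s t) k)) ⟩
  (Φ H s t k + Φ K s t k) − mul1-z (FH ⊙ FK) k      ∎
  where
  open CommutativeRing R using (_≈_; _+_; _*_; setoid; trans; +-cong; +-congʳ)
  open Spread R p
  open SpreadProperties R p
  open import Relation.Binary.Reasoning.Setoid setoid

  FH FK : Series
  FH = div1-z (Φ H s t)
  FK = div1-z (Φ K s t)

  t∈H∩K : t ∈ verts H ∩ verts K
  t∈H∩K = ≡.subst (t ∈_) (≡.sym H∩K≡st) (x∈p∪q⁺ (inj₂ (x∈⁅x⁆ t)))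

  surv-splits : ∀ k → surv (edges G) t k ⁅ s ⁆ ≈ surv (edges H) t k ⁅ s ⁆ * surv (edges K) t k ⁅ s ⁆
  surv-splits k = trans (surv-↭ G↭H++K t k ⁅ s ⁆)
                        (surv-++ (edgesInside H) (edgesInside K) (⊆-reflexive H∩K≡st)
                                 (proj₁ (x∈p∩q⁻ _ _ t∈H∩K)) (proj₂ (x∈p∩q⁻ _ _ t∈H∩K)) k ⁅ s ⁆ (x∈⁅x⁆ s))

  cdf-splits : ∀ k → div1-z (Φ G s t) k ≈ ((FH +ₛ FK) −ₛ (FH ⊙ FK)) k
  cdf-splits k = inclusion-exclusion (cdf+surv≈1 H t ⁅ s ⁆ k) (cdf+surv≈1 K t ⁅ s ⁆ k)
                                     (cdf+surv≈1 G t ⁅ s ⁆ k) (surv-splits k)
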